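{- For every positive integer $M$, the minimum nonnegative integer $\ell$ for which $K(\ell)\ge M$ equals $h(M)$.
   Context: A natural graph is a simple graph whose vertex set is a finite subset of $\mathbb{N}=\{1,2,\dots\}$. An infinite permutation of $\mathbb{N}$ is a sequence $(\pi(1),\pi(2),\dots)$ in which every positive integer occurs exactly once. For a natural graph $G$, two infinite permutations $\pi,\sigma$ are $G$-different if $\{\pi(i),\sigma(i)\}\in E(G)$ for some $i$. $\kappa(G)$ is the maximum cardinality of a set of pairwise $G$-different infinite permutations, and $K(\ell)=\max\{\kappa(G): G\text{ natural graph}, |E(G)|=\ell\}$. The (undirected) line graph $L(D)$ of a directed graph $D=(V,A)$ (possibly with multiple arcs) has vertex set $A$, and two distinct arcs $(a,b),(c,d)$ are adjacent iff $b=c$ or $a=d$. $\mathcal{L}$ is the family of all finite simple graphs isomorphic to $L(D)$ for some directed graph $D$ with possibly multiple arcs. $h(n)$ is the minimum number of graphs in $\mathcal{L}$, each with vertex set $V(K_n)$, whose edge sets together cover all edges of the complete graph $K_n$. -}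

module Defs where

open import Level using (Level; _⊔_)
open import Data.Nat using (ℕ; _<_; _≤_)
open import Data.Fin using (Fin)
open import Data.Product using (Σ; _×_; _,_; proj₁; proj₂; ∃; ∃-syntax)
open import Data.Sum using (_⊎_)
open import Data.List using (List; length)
open import Data.List.Membership.Propositional using (_∈_)
open import Data.List.Relation.Unary.All using (All)
open import Data.List.Relation.Unary.Unique.Propositional using (Unique)
open import Relation.Binary.PropositionalEquality using (_≡_; _≢_)
open import Relation.Nullary using (¬_)
open import Function.Bundles using (_⤖_; Bijection; _⇔_)

-- An edge {u,v} is stored canonically as the ordered pair (u , v) with u < v.
record NaturalGraph : Set where
  field
    vertices      : List ℕ
    verticesUniq  : Unique vertices
    edges         : List (ℕ × ℕ)
    edgesUniq     : Unique edges
    edgesOrdered  : All (λ e → proj₁ e < proj₂ e) edges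
    edgesInV      : All (λ e → (proj₁ e ∈ vertices) × (proj₂ e ∈ vertices)) edges

open NaturalGraph public

numEdges : NaturalGraph → ℕ
numEdges G = length (edges G)

EdgeOf : NaturalGraph → ℕ → ℕ → Set
EdgeOf G a b = ((a , b) ∈ edges G) ⊎ ((b , a) ∈ edges G)

InfPerm : Set
InfPerm = ℕ ⤖ ℕ

app : InfPerm → ℕ → ℕ
app π = Bijection.to π

GDifferent : NaturalGraph → InfPerm → InfPerm → Set
GDifferent G π σ = ∃[ i ] EdgeOf G (app π i) (app σ i)

-- κ(G) ≥ M : there is a set of M pairwise G-different infinite permutations
-- (given as an M-indexed family; pairwise G-difference of distinct indices
-- forces the members to be distinct, so the set has exactly M elements).
κ≥ : NaturalGraph → ℕ → Set
κ≥ G M = Σ (Fin M → InfPerm) λ ps →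
           ∀ (i j : Fin M) → i ≢ j → GDifferent G (ps i) (ps j)

-- K(ℓ) ≥ M  (K(ℓ) is the maximum of κ(G) over natural graphs with ℓ edges)
K≥ : ℕ → ℕ → Set
K≥ ℓ M = Σ NaturalGraph λ G → (numEdges G ≡ ℓ) × κ≥ G M

record SimpleGraph (n : ℕ) : Set₁ where
  field
    Adj     : Fin n → Fin n → Set
    symAdj  : ∀ {u v} → Adj u v → Adj v u
    irrAdj  : ∀ {u} → ¬ Adj u u

open SimpleGraph public

-- Directed graphs with possibly multiple arcs (no loops), with finitely many
-- arcs, indexed by Fin numArcs; vertices are natural numbers.
record Digraph : Set where
  field
    numArcs : ℕ
    tail    : Fin numArcs → ℕ
    head    : Fin numArcs → ℕ
    noLoop  : ∀ x → tail x ≢ head x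

open Digraph public

LineAdj : (D : Digraph) → Fin (numArcs D) → Fin (numArcs D) → Set
LineAdj D x y = (x ≢ y) × ((head D x ≡ tail D y) ⊎ (tail D x ≡ head D y))

InL : ∀ {n} → SimpleGraph n → Set
InL {n} H = Σ Digraph λ D → Σ (Fin n ⤖ Fin (numArcs D)) λ f →
              ∀ u v → Adj H u v ⇔ LineAdj D (Bijection.to f u) (Bijection.to f v)

LCover : ℕ → ℕ → Set₁
LCover k n = Σ (Fin k → SimpleGraph n) λ Hs →
               (∀ j → InL (Hs j)) ×
               (∀ (u v : Fin n) → u ≢ v → ∃[ j ] Adj (Hs j) u v)

IsLeast : ∀ {a} → (ℕ → Set a) → ℕ → Set a
IsLeast P n = P n × (∀ m → P m → n ≤ m)

-- Both minima equal the least k for which K_M is covered by the line graphs of k digraphs whose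
-- arcs are the vertices of K_M.  Given M pairwise G-different permutations, each edge {a , b} of G
-- yields the digraph whose arc u runs from π_u⁻¹(a) to π_u⁻¹(b).  Conversely, a cover by k
-- digraphs on B vertices is realised by a graph with k disjoint edges: digraph j gets a block of
-- B + 2 points, and π_u swaps the tail and head of arc u with the two ends of edge j.  Each digraph
-- uses at most 2M vertices, so covers may be taken on a fixed set of 3 + 2M vertices; then having a
-- cover of size k is decidable, and the star cover of size M makes the least k exist.
module Submission where

open import Defs
open import Level using (0ℓ)
open import Function using (_∘_)
open import Data.Empty using (⊥-elim-irr)
open import Data.Nat using (ℕ; zero; suc; _+_; _*_; _<_; _≤_; _<?_; z<s)
open import Data.Nat.Properties using (≤-refl; ≮⇒≥; m<n⇒m<1+n; m<1+n⇒m<n∨m≡n; m≤n+m; <⇒≢; +-monoʳ-<)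
  renaming (_≟_ to _≟ℕ_)
open import Data.Fin using (Fin; zero; suc; toℕ; fromℕ<; inject≤; combine; remQuot)
open import Data.Fin.Properties
  using (any?; all?; suc-injective; toℕ-fromℕ<; fromℕ<-toℕ; toℕ<n; toℕ-injective; inject≤-injective;
         remQuot-combine; combine-remQuot; toℕ-combine; combine-injectiveˡ)
  renaming (_≟_ to _≟ᶠ_)
open import Data.Fin.Permutation using (Permutation′; permutation; _⟨$⟩ʳ_; _⟨$⟩ˡ_; inverseˡ; inverseʳ; transpose; _∘ₚ_)
import Data.Fin.Permutation.Components as PC
open import Data.Product using (Σ; ∃; ∃-syntax; _×_; _,_; proj₁; proj₂)
open import Data.Sum using (_⊎_; inj₁; inj₂; [_,_])
open import Data.Vec using (Vec; []; _∷_; lookup; tabulate)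
open import Data.Vec.Properties using (lookup∘tabulate)
open import Data.List as List using (List; length; _++_)
open import Data.List.Properties using (length-++; length-tabulate)
open import Data.List.Membership.Propositional using (_∈_)
open import Data.List.Membership.Propositional.Properties using (∈-lookup; ∈-tabulate⁺; ∈-++⁺ˡ; ∈-++⁺ʳ)
open import Data.List.Relation.Unary.Any using (index)
open import Data.List.Relation.Unary.Any.Properties using (lookup-index)
import Data.List.Relation.Unary.All as All
import Data.List.Relation.Unary.All.Properties as All
import Data.List.Relation.Unary.Unique.Propositional.Properties as Unique
open import Relation.Unary using (Pred; Decidable)
open import Relation.Binary.Definitions using (DecidableEquality)
open import Relation.Binary.PropositionalEquality
  using (_≡_; _≢_; refl; sym; trans; cong; cong₂; subst; subst₂; module ≡-Reasoning)
open import Relation.Nullary using (¬_; Dec; yes; no; ¬?; contradiction)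
open import Relation.Nullary.Decidable using (map′; _×-dec_; _⊎-dec_; _→-dec_; dec-true; dec-false)
open import Function.Bundles using (Bijection; Inverse; Equivalence; mk↔ₛ′)
open import Function.Construct.Identity using (⤖-id; ⇔-id)
open import Function.Properties.Bijection using (⤖⇒↔)
open import Function.Properties.Inverse using (↔⇒⤖)

private
  variable
    A V : Set
    k M B : ℕ

Searchable : Set → Set₁
Searchable A = (P : Pred A 0ℓ) → Decidable P → Dec (∃ P)

searchable-Fin : ∀ n → Searchable (Fin n)
searchable-Fin n P P? = any? P?

searchable-× : Searchable A → Searchable V → Searchable (A × V)
searchable-× searchA searchV P P? =
  map′ (λ (a , b , p) → (a , b) , p) (λ ((a , b) , p) → a , b , p)
       (searchA (λ a → ∃[ b ] P (a , b)) (λ a → searchV (λ b → P (a , b)) (λ b → P? (a , b))))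

searchable-Vec : Searchable A → ∀ n → Searchable (Vec A n)
searchable-Vec searchA zero P P? = map′ ([] ,_) (λ { ([] , p) → p }) (P? [])
searchable-Vec searchA (suc n) P P? =
  map′ (λ (a , v , p) → a ∷ v , p) (λ { (a ∷ v , p) → a , v , p })
       (searchA (λ a → ∃[ v ] P (a ∷ v)) (λ a → searchable-Vec searchA n (λ v → P (a ∷ v)) (λ v → P? (a ∷ v))))

leastBelow : {P : Pred ℕ 0ℓ} → Decidable P → ∀ n → (∃[ m ] m < n × IsLeast P m) ⊎ (∀ m → m < n → ¬ P m)
leastBelow P? zero = inj₂ (λ _ ())
leastBelow P? (suc n) with leastBelow P? n
... | inj₁ (m , m<n , m-least) = inj₁ (m , m<n⇒m<1+n m<n , m-least)
... | inj₂ none with P? n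
...   | yes Pn = inj₁ (n , ≤-refl , Pn , λ m Pm → ≮⇒≥ (λ m<n → none m m<n Pm))
...   | no ¬Pn = inj₂ λ m m<1+n → [ none m , (λ { refl → ¬Pn }) ] (m<1+n⇒m<n∨m≡n m<1+n)

least : {P : Pred ℕ 0ℓ} → Decidable P → ∀ {n} → P n → ∃ (IsLeast P)
least P? {n} Pn with leastBelow P? (suc n)
... | inj₁ (m , _ , m-least) = m , m-least
... | inj₂ none = contradiction Pn (none n ≤-refl)

-- Arcs of one directed multigraph on V, indexed by the vertices Fin M of K_M.
Arcs : ℕ → Set → Set
Arcs M V = Fin M → V × V

Loopless : Arcs M V → Set
Loopless r = ∀ u → proj₁ (r u) ≢ proj₂ (r u)

Consecutive : V × V → V × V → Set
Consecutive a b = (proj₂ a ≡ proj₁ b) ⊎ (proj₁ a ≡ proj₂ b)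

IsLineGraphCover : (Fin k → Arcs M V) → Set
IsLineGraphCover rs =
  (∀ j → Loopless (rs j)) × (∀ u v → u ≢ v → ∃[ j ] Consecutive (rs j u) (rs j v))

LineGraphCover : ℕ → ℕ → Set → Set
LineGraphCover k M V = Σ (Fin k → Arcs M V) IsLineGraphCover

isLineGraphCover? : DecidableEquality V → Decidable (IsLineGraphCover {k} {M} {V})
isLineGraphCover? _≟_ rs =
  all? (λ j → all? λ u → ¬? (proj₁ (rs j u) ≟ proj₂ (rs j u)))
  ×-dec
  all? (λ u → all? λ v → ¬? (u ≟ᶠ v) →-dec
    any? λ j → (proj₂ (rs j u) ≟ proj₁ (rs j v)) ⊎-dec (proj₁ (rs j u) ≟ proj₂ (rs j v)))

isLineGraphCover-resp : {rs rs′ : Fin k → Arcs M V} →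
  (∀ j u → rs j u ≡ rs′ j u) → IsLineGraphCover rs → IsLineGraphCover rs′
isLineGraphCover-resp eq (loopless , covers) =
  (λ j u → subst (λ a → proj₁ a ≢ proj₂ a) (eq j u) (loopless j u)) ,
  λ u v u≢v → let (j , c) = covers u v u≢v in j , subst₂ Consecutive (eq j u) (eq j v) c

lineGraphCover? : ∀ M B k → Dec (LineGraphCover k M (Fin B))
lineGraphCover? M B k =
  map′ (λ (t , c) → table t , c)
       (λ (rs , c) → tabulate (tabulate ∘ rs) , isLineGraphCover-resp (table-tabulate rs) c)
       (searchable-Vec (searchable-Vec (searchable-× (searchable-Fin B) (searchable-Fin B)) M) k
                       (IsLineGraphCover ∘ table) (isLineGraphCover? _≟ᶠ_ ∘ table))
  where
  table : Vec (Vec (Fin B × Fin B) M) k → Fin k → Arcs M (Fin B)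
  table t j u = lookup (lookup t j) u

  table-tabulate : ∀ rs j u → rs j u ≡ table (tabulate (tabulate ∘ rs)) j u
  table-tabulate rs j u =
    sym (trans (cong (λ row → lookup row u) (lookup∘tabulate _ j)) (lookup∘tabulate (rs j) u))

-- In round j the arc of j is 0 → 1 and every other arc is 1 → 2.
starCover : ∀ {n} M → LineGraphCover M M (Fin (3 + n))
starCover {n} M = (λ j u → star (j ≟ᶠ u)) , loopless , λ u v u≢v → u , consecutive u v u≢v
  where
  star : ∀ {P : Set} → Dec P → Fin (3 + n) × Fin (3 + n)
  star (yes _) = zero , suc zero
  star (no _)  = suc zero , suc (suc zero)

  loopless : ∀ j → Loopless (λ u → star (j ≟ᶠ u))
  loopless j u with j ≟ᶠ u
  ... | yes _ = λ ()
  ... | no _  = λ ()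

  consecutive : ∀ u v → u ≢ v → Consecutive (star (u ≟ᶠ u)) (star (u ≟ᶠ v))
  consecutive u v u≢v with u ≟ᶠ u | u ≟ᶠ v
  ... | yes _   | no _    = inj₁ refl
  ... | no u≢u  | _       = contradiction refl u≢u
  ... | yes _   | yes u≡v = contradiction u≡v u≢v

-- Renames every endpoint of r by a position where it occurs in the list of all 2M endpoints.
module Compress (_≟_ : DecidableEquality V) (r : Arcs M V) where
  open import Data.List.Membership.DecPropositional _≟_ using (_∈?_)

  endpoints : List V
  endpoints = List.tabulate (proj₁ ∘ r) ++ List.tabulate (proj₂ ∘ r)

  length-endpoints : length endpoints ≡ M + M
  length-endpoints = trans (length-++ (List.tabulate (proj₁ ∘ r)))
                           (cong₂ _+_ (length-tabulate (proj₁ ∘ r)) (length-tabulate (proj₂ ∘ r)))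

  position : (x : V) → .(x ∈ endpoints) → Fin (length endpoints)
  position x x∈ with x ∈? endpoints
  ... | yes p  = index p
  ... | no x∉  = ⊥-elim-irr (x∉ x∈)

  lookup-position : ∀ x .(x∈ : x ∈ endpoints) → List.lookup endpoints (position x x∈) ≡ x
  lookup-position x x∈ with x ∈? endpoints
  ... | yes p  = sym (lookup-index p)
  ... | no x∉  = ⊥-elim-irr (x∉ x∈)

  module _ (M+M≤B : M + M ≤ B) where
    code : (x : V) → .(x ∈ endpoints) → Fin B
    code x x∈ = inject≤ (position x x∈) (subst (_≤ B) (sym length-endpoints) M+M≤B)

    code-injective : ∀ {x y} .{x∈ : x ∈ endpoints} .{y∈ : y ∈ endpoints} → code x x∈ ≡ code y y∈ → x ≡ y
    code-injective {x} {y} {x∈} {y∈} eq = begin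
      x                                          ≡⟨ lookup-position x x∈ ⟨
      List.lookup endpoints (position x x∈)      ≡⟨ cong (List.lookup endpoints) (inject≤-injective _ _ _ _ eq) ⟩
      List.lookup endpoints (position y y∈)      ≡⟨ lookup-position y y∈ ⟩
      y                                          ∎
      where open ≡-Reasoning

    code-cong : ∀ {x y} .{x∈ : x ∈ endpoints} .{y∈ : y ∈ endpoints} → x ≡ y → code x x∈ ≡ code y y∈
    code-cong refl = refl

    compressed : Arcs M (Fin B)
    compressed u = code (proj₁ (r u)) (∈-++⁺ˡ (∈-tabulate⁺ u)) , code (proj₂ (r u)) (∈-++⁺ʳ _ (∈-tabulate⁺ u))

    compressed-loopless : Loopless r → Loopless compressed
    compressed-loopless loopless u = loopless u ∘ code-injective

    compressed-consecutive : ∀ {u v} → Consecutive (r u) (r v) → Consecutive (compressed u) (compressed v)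
    compressed-consecutive (inj₁ eq) = inj₁ (code-cong eq)
    compressed-consecutive (inj₂ eq) = inj₂ (code-cong eq)

compress : DecidableEquality V → M + M ≤ B → LineGraphCover k M V → LineGraphCover k M (Fin B)
compress _≟_ M+M≤B (rs , loopless , covers) =
  (λ j → C.compressed (rs j) M+M≤B) ,
  (λ j → C.compressed-loopless (rs j) M+M≤B (loopless j)) ,
  λ u v u≢v → let (j , c) = covers u v u≢v in j , C.compressed-consecutive (rs j) M+M≤B c
  where module C = Compress _≟_

digraph : (r : Arcs M ℕ) → Loopless r → Digraph
digraph {M} r loopless = record { numArcs = M ; tail = proj₁ ∘ r ; head = proj₂ ∘ r ; noLoop = loopless }

lineGraph : (D : Digraph) → SimpleGraph (numArcs D)
lineGraph D = record { Adj = LineAdj D ; symAdj = symmetric ; irrAdj = λ (x≢x , _) → x≢x refl }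
  where
  symmetric : ∀ {x y} → LineAdj D x y → LineAdj D y x
  symmetric (x≢y , inj₁ eq) = x≢y ∘ sym , inj₂ (sym eq)
  symmetric (x≢y , inj₂ eq) = x≢y ∘ sym , inj₁ (sym eq)

lineGraph∈L : (D : Digraph) → InL (lineGraph D)
lineGraph∈L D = D , ⤖-id _ , λ _ _ → ⇔-id _

lineGraphCover⇒LCover : LineGraphCover k M ℕ → LCover k M
lineGraphCover⇒LCover (rs , loopless , covers) =
  (λ j → lineGraph (digraph (rs j) (loopless j))) ,
  (λ j → lineGraph∈L (digraph (rs j) (loopless j))) ,
  λ u v u≢v → let (j , c) = covers u v u≢v in j , u≢v , c

LCover⇒lineGraphCover : LCover k M → LineGraphCover k M ℕ
LCover⇒lineGraphCover (Hs , Hs∈L , covers) = arcs , loopless , covers′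
  where
  arcs : Fin _ → Arcs _ ℕ
  arcs j u = let (D , f , _) = Hs∈L j in tail D (Bijection.to f u) , head D (Bijection.to f u)

  loopless : ∀ j → Loopless (arcs j)
  loopless j u = let (D , f , _) = Hs∈L j in noLoop D (Bijection.to f u)

  covers′ : ∀ u v → u ≢ v → ∃[ j ] Consecutive (arcs j u) (arcs j v)
  covers′ u v u≢v = let (j , adj) = covers u v u≢v ; (_ , _ , Adj⇔LineAdj) = Hs∈L j in
    j , proj₂ (Equivalence.to (Adj⇔LineAdj u v) adj)

K≥⇒lineGraphCover : ∀ {ℓ} → K≥ ℓ M → LineGraphCover ℓ M ℕ
K≥⇒lineGraphCover (G , refl , πs , different) = arcs , loopless , covers
  where
  preimage : InfPerm → ℕ → ℕ
  preimage π = Inverse.from (⤖⇒↔ π)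

  preimage-unique : ∀ π {i x} → app π i ≡ x → preimage π x ≡ i
  preimage-unique π refl = Inverse.strictlyInverseʳ (⤖⇒↔ π) _

  preimage-injective : ∀ π {x y} → preimage π x ≡ preimage π y → x ≡ y
  preimage-injective π {x} {y} eq = trans (sym (Inverse.strictlyInverseˡ (⤖⇒↔ π) x))
    (trans (cong (app π) eq) (Inverse.strictlyInverseˡ (⤖⇒↔ π) y))

  arcs : Fin (numEdges G) → Arcs _ ℕ
  arcs j u = let (a , b) = List.lookup (edges G) j in preimage (πs u) a , preimage (πs u) b

  loopless : ∀ j → Loopless (arcs j)
  loopless j u = <⇒≢ (All.lookup (edgesOrdered G) (∈-lookup j)) ∘ preimage-injective (πs u)

  covers : ∀ u v → u ≢ v → ∃[ j ] Consecutive (arcs j u) (arcs j v)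
  covers u v u≢v with different u v u≢v
  ... | _ , inj₁ e = index e , inj₂ (trans (preimage-unique (πs u) (cong proj₁ (lookup-index e)))
                                         (sym (preimage-unique (πs v) (cong proj₂ (lookup-index e)))))
  ... | _ , inj₂ e = index e , inj₁ (trans (preimage-unique (πs u) (cong proj₂ (lookup-index e)))
                                         (sym (preimage-unique (πs v) (cong proj₁ (lookup-index e)))))

module _ {N : ℕ} where

  extendFun : (Fin N → Fin N) → ℕ → ℕ
  extendFun f i with i <? N
  ... | yes i<N = toℕ (f (fromℕ< i<N))
  ... | no _    = i

  extendFun-toℕ : ∀ f y → extendFun f (toℕ y) ≡ toℕ (f y)
  extendFun-toℕ f y with toℕ y <? N
  ... | yes y<N = cong (toℕ ∘ f) (fromℕ<-toℕ y y<N)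
  ... | no y≮N  = contradiction (toℕ<n y) y≮N

  extendFun-≥ : ∀ f {i} → ¬ i < N → extendFun f i ≡ i
  extendFun-≥ f {i} i≮N with i <? N
  ... | yes i<N = contradiction i<N i≮N
  ... | no _    = refl

  extendFun-inverse : ∀ {f g} → (∀ y → f (g y) ≡ y) → ∀ i → extendFun f (extendFun g i) ≡ i
  extendFun-inverse {f} {g} f∘g≡id i with i <? N
  ... | yes i<N = trans (extendFun-toℕ f _) (trans (cong toℕ (f∘g≡id _)) (toℕ-fromℕ< i<N))
  ... | no i≮N  = extendFun-≥ f i≮N

  extend : Permutation′ N → InfPerm
  extend π = ↔⇒⤖ (mk↔ₛ′ (extendFun (π ⟨$⟩ʳ_)) (extendFun (π ⟨$⟩ˡ_))
                         (extendFun-inverse (λ _ → inverseʳ π)) (extendFun-inverse (λ _ → inverseˡ π)))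

  app-extend-toℕ : ∀ π y → app (extend π) (toℕ y) ≡ toℕ (π ⟨$⟩ʳ y)
  app-extend-toℕ π = extendFun-toℕ (π ⟨$⟩ʳ_)

module _ {k S : ℕ} where

  onBlocks : (Fin k → Fin S → Fin S) → Fin (k * S) → Fin (k * S)
  onBlocks f y = let (j , w) = remQuot {k} S y in combine j (f j w)

  onBlocks-combine : ∀ f j w → onBlocks f (combine j w) ≡ combine j (f j w)
  onBlocks-combine f j w = cong (λ (j , w) → combine j (f j w)) (remQuot-combine j w)

  onBlocks-inverse : ∀ f g → (∀ j w → f j (g j w) ≡ w) → ∀ y → onBlocks f (onBlocks g y) ≡ y
  onBlocks-inverse f g f∘g≡id y = let (j , w) = remQuot {k} S y in
    trans (onBlocks-combine f j (g j w)) (trans (cong (combine j) (f∘g≡id j w)) (combine-remQuot {k} S y))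

  blockwise : (Fin k → Permutation′ S) → Permutation′ (k * S)
  blockwise σ = permutation (onBlocks to) (onBlocks from)
                            (onBlocks-inverse to from (λ j _ → inverseʳ (σ j)))
                            (onBlocks-inverse from to (λ j _ → inverseˡ (σ j)))
    where
    to from : Fin k → Fin S → Fin S
    to j = σ j ⟨$⟩ʳ_
    from j = σ j ⟨$⟩ˡ_

  blockwise-combine : ∀ σ j w → blockwise σ ⟨$⟩ʳ combine j w ≡ combine j (σ j ⟨$⟩ʳ w)
  blockwise-combine σ = onBlocks-combine (λ j → σ j ⟨$⟩ʳ_)

transpose-matchʳ : ∀ {n} (i j : Fin n) → PC.transpose i j j ≡ i
transpose-matchʳ i j with j ≟ᶠ i
... | yes j≡i = j≡i
... | no _ rewrite dec-true (j ≟ᶠ j) refl = refl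

transpose-other : ∀ {n} (i j : Fin n) {x} → x ≢ i → x ≢ j → PC.transpose i j x ≡ x
transpose-other i j {x} x≢i x≢j rewrite dec-false (x ≟ᶠ i) x≢i | dec-false (x ≟ᶠ j) x≢j = refl

-- On Fin (2 + B), with vertex x of the digraph sitting at 2 + x: the arc t → h is routed onto 0 → 1.
route : Fin B × Fin B → Permutation′ (2 + B)
route (t , h) = transpose (suc zero) (suc (suc h)) ∘ₚ transpose zero (suc (suc t))

route-tail : ∀ (t h : Fin B) → t ≢ h → route (t , h) ⟨$⟩ʳ suc (suc t) ≡ zero
route-tail t h t≢h =
  trans (cong (PC.transpose zero (suc (suc t)))
              (transpose-other (suc zero) (suc (suc h)) (λ ()) (t≢h ∘ suc-injective ∘ suc-injective)))
        (transpose-matchʳ zero (suc (suc t)))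

route-head : ∀ (t h : Fin B) → route (t , h) ⟨$⟩ʳ suc (suc h) ≡ suc zero
route-head t h =
  trans (cong (PC.transpose zero (suc (suc t))) (transpose-matchʳ (suc zero) (suc (suc h))))
        (transpose-other zero (suc (suc t)) (λ ()) (λ ()))

-- Round j of the cover occupies the block of slots combine j w; its edge joins slots 0 and 1.
module BlockConstruction (rs : Fin k → Arcs M (Fin B)) where

  slot : Fin k → Fin (2 + B) → ℕ
  slot j w = toℕ (combine j w)

  slot₀<slot₁ : ∀ j → slot j zero < slot j (suc zero)
  slot₀<slot₁ j = subst₂ _<_ (sym (toℕ-combine j zero)) (sym (toℕ-combine j (suc zero)))
                            (+-monoʳ-< ((2 + B) * toℕ j) z<s)

  graph : NaturalGraph
  graph = record
    { vertices     = List.tabulate {n = k * (2 + B)} toℕ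
    ; verticesUniq = Unique.tabulate⁺ toℕ-injective
    ; edges        = List.tabulate λ j → slot j zero , slot j (suc zero)
    ; edgesUniq    = Unique.tabulate⁺ λ {i} {j} eq →
                       combine-injectiveˡ i zero j zero (toℕ-injective (cong proj₁ eq))
    ; edgesOrdered = All.tabulate⁺ slot₀<slot₁
    ; edgesInV     = All.tabulate⁺ λ j → ∈-tabulate⁺ (combine j zero) , ∈-tabulate⁺ (combine j (suc zero))
    }

  perm : Fin M → InfPerm
  perm u = extend (blockwise λ j → route (rs j u))

  app-perm-slot : ∀ u j w → app (perm u) (slot j w) ≡ slot j (route (rs j u) ⟨$⟩ʳ w)
  app-perm-slot u j w = trans (app-extend-toℕ (blockwise σ) (combine j w)) (cong toℕ (blockwise-combine σ j w))
    where
    σ : Fin k → Permutation′ (2 + B)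
    σ j = route (rs j u)

  module _ (loopless : ∀ j → Loopless (rs j)) where

    app-perm-tail : ∀ {u j x} → x ≡ proj₁ (rs j u) → app (perm u) (slot j (suc (suc x))) ≡ slot j zero
    app-perm-tail {u} {j} refl =
      trans (app-perm-slot u j _) (cong (slot j) (route-tail (proj₁ (rs j u)) (proj₂ (rs j u)) (loopless j u)))

    app-perm-head : ∀ {u j x} → x ≡ proj₂ (rs j u) → app (perm u) (slot j (suc (suc x))) ≡ slot j (suc zero)
    app-perm-head {u} {j} refl =
      trans (app-perm-slot u j _) (cong (slot j) (route-head (proj₁ (rs j u)) (proj₂ (rs j u))))

    different : ∀ {u v} j → Consecutive (rs j u) (rs j v) → GDifferent graph (perm u) (perm v)
    different {u} {v} j (inj₁ head≡tail) = slot j (suc (suc (proj₂ (rs j u)))) , inj₂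
      (subst₂ (λ x y → (x , y) ∈ edges graph)
              (sym (app-perm-tail head≡tail)) (sym (app-perm-head refl)) (∈-tabulate⁺ j))
    different {u} {v} j (inj₂ tail≡head) = slot j (suc (suc (proj₁ (rs j u)))) , inj₁
      (subst₂ (λ x y → (x , y) ∈ edges graph)
              (sym (app-perm-tail refl)) (sym (app-perm-head tail≡head)) (∈-tabulate⁺ j))

lineGraphCover⇒K≥ : LineGraphCover k M (Fin B) → K≥ k M
lineGraphCover⇒K≥ (rs , loopless , covers) =
  graph , length-tabulate _ , perm ,
  λ u v u≢v → let (j , c) = covers u v u≢v in different loopless j c
  where open BlockConstruction rs

proposition7 : ∀ (M : ℕ) → 1 ≤ M →
    Σ ℕ (λ n → IsLeast (λ ℓ → K≥ ℓ M) n × IsLeast (λ k → LCover k M) n)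
proposition7 M _ with least (lineGraphCover? M (3 + (M + M))) (starCover M)
... | n , cover , minimal =
  n , (K≥n , λ ℓ → minimal ℓ ∘ shrink ∘ K≥⇒lineGraphCover) ,
      (lineGraphCover⇒LCover (K≥⇒lineGraphCover K≥n) , λ k → minimal k ∘ shrink ∘ LCover⇒lineGraphCover)
  where
  K≥n : K≥ n M
  K≥n = lineGraphCover⇒K≥ cover

  shrink : ∀ {k} → LineGraphCover k M ℕ → LineGraphCover k M (Fin (3 + (M + M)))
  shrink = compress _≟ℕ_ (m≤n+m (M + M) 3)
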